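{- Let $n\ge 2$ be an integer and let $g:\mathbb{N}\to\mathbb{N}$ be a function such that for every $x\in\mathbb{N}$, every tournament $T'$ with $\overrightarrow{\omega}(T')\ge g(x)$ has a vertex whose out-neighbourhood has clique number at least $x$ and a vertex whose in-neighbourhood has clique number at least $x$. Let $T$ be a tournament and $c$ an integer such that every subtournament $T'$ of $T$ with $\overrightarrow{\omega}(T')\geq c$ contains a copy of $D_{n-1}$. Let $c_{\mathrm{small}}\geq c$ and $c_{\mathrm{large}}$ be integers, and let $A,B$ be disjoint subsets of $V(T)$ such that $\overrightarrow{\omega}(A)\geq c_{\mathrm{large}}$, $\overrightarrow{\omega}(B)\geq c_{\mathrm{large}}+g\big((1+|V(D_{n-1})|)\,c_{\mathrm{small}}\big)$, and $\overrightarrow{\omega}(N^-(v)\cap B)<c_{\mathrm{small}}$ for each $v\in A$. Then either (a) $T$ contains $D_n$ as a subtournament, or (b) there exists $B_2\subseteq B$ with $\overrightarrow{\omega}(B_2)\geq c_{\mathrm{large}}$ such that $\overrightarrow{\omega}(N^+(w)\cap A)<c$ for each $w\in B_2$. The same statement also holds with the roles of out-neighbourhoods and in-neighbourhoods swapped throughout.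
   Context: A tournament is a finite directed graph with exactly one arc between each pair of distinct vertices; $N^+(v)$, $N^-(v)$ denote out- and in-neighbourhoods. For a total ordering $<$ of $V(T)$, the backedge graph $B(T,<)$ is the graph on $V(T)$ with an edge $uv$ for every pair $u<v$ with $vu \in A(T)$; $\overrightarrow{\omega}(T)=\min_<\omega(B(T,<))$ over all total orderings, and for $X\subseteq V(T)$, $\overrightarrow{\omega}(X)=\overrightarrow{\omega}(T[X])$. A tournament contains (a copy of) $H$ if some induced subtournament is isomorphic to $H$. For disjoint vertex sets $X,Y$, $X\Rightarrow Y$ means $xy$ is an arc for all $x\in X,y\in Y$. The tournament $D_1$ is a single vertex, and $D_n$ is obtained from two disjoint copies $T_1,T_2$ of $D_{n-1}$ and one further vertex $w$ with $V(T_1)\Rightarrow V(T_2)$, $V(T_2)\Rightarrow w$, $w \Rightarrow V(T_1)$; thus $|V(D_{n-1})|=2^{n-1}-1$. (Such a function $g$ exists.) -}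

module Defs where

open import Data.Nat using (ℕ; zero; suc; _+_; _≤_)
open import Data.Bool using (Bool; true; false; not)
open import Data.Fin using (Fin; splitAt)
open import Data.Fin.Subset using (Subset; _∈_)
open import Data.Vec using (tabulate)
open import Data.List using (List; length)
import Data.List.Membership.Propositional as LM
open import Data.List.Relation.Unary.Unique.Propositional using (Unique)
open import Data.List.Relation.Unary.AllPairs using (AllPairs)
open import Data.List.Relation.Binary.Sublist.Propositional using () renaming (_⊆_ to _⊑_)
open import Data.Product using (Σ; ∃; _×_; _,_)
open import Data.Sum using (_⊎_; inj₁; inj₂)
open import Data.Unit using (⊤; tt)
open import Function.Definitions using (Injective)
open import Relation.Binary.PropositionalEquality using (_≡_; _≢_)
open import Relation.Nullary using (¬_)

-- Tournaments on vertex set Fin size.  adj u v ≡ true  means  uv ∈ A(T).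

record Tournament : Set where
  field
    size  : ℕ
    adj   : Fin size → Fin size → Bool
    irrefl : ∀ v → adj v v ≡ false
    tourn : ∀ u v → u ≢ v → adj u v ≡ not (adj v u)

open Tournament public

V : (T : Tournament) → Subset (size T)
V T = tabulate (λ _ → true)

N⁺ : (T : Tournament) → Fin (size T) → Subset (size T)
N⁺ T v = tabulate (λ u → adj T v u)

N⁻ : (T : Tournament) → Fin (size T) → Subset (size T)
N⁻ T v = tabulate (λ u → adj T u v)

-- Total orderings of a vertex subset X: a duplicate-free list whose
-- elements are exactly the members of X (earlier in the list = smaller).

record Ordering (T : Tournament) (X : Subset (size T)) : Set where
  field
    list    : List (Fin (size T))
    unique  : Unique list
    sound   : ∀ v → v LM.∈ list → v ∈ X
    complete : ∀ v → v ∈ X → v LM.∈ list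

open Ordering public

-- A clique of the backedge graph B(T[X],<): a subsequence of the ordering
-- such that for every pair u < v (u earlier) in it, vu is an arc of T.
BackedgeClique : (T : Tournament) {X : Subset (size T)} → Ordering T X → List (Fin (size T)) → Set
BackedgeClique T o S = (S ⊑ list o) × AllPairs (λ u v → adj T v u ≡ true) S

ωB≥ : (T : Tournament) {X : Subset (size T)} → Ordering T X → ℕ → Set
ωB≥ T o k = Σ (List _) λ S → BackedgeClique T o S × k ≤ length S

-- ω⃗(X) ≥ k, where ω⃗(X) = min over orderings < of ω(B(T[X],<)):
-- every total ordering of X has a backedge clique of size ≥ k.
infix 4 ω⃗[_]_≥_ ω⃗[_]_<_
ω⃗[_]_≥_ : (T : Tournament) → Subset (size T) → ℕ → Set
ω⃗[ T ] X ≥ k = (o : Ordering T X) → ωB≥ T o k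

ω⃗[_]_<_ : (T : Tournament) → Subset (size T) → ℕ → Set
ω⃗[ T ] X < k = ¬ (ω⃗[ T ] X ≥ k)

ContainsIn : (T : Tournament) → Subset (size T) → (k : ℕ) → (Fin k → Fin k → Bool) → Set
ContainsIn T X k h =
  Σ (Fin k → Fin (size T)) λ f →
    Injective _≡_ _≡_ f × (∀ i → f i ∈ X) × (∀ i j → adj T (f i) (f j) ≡ h i j)

-- We start from the empty tournament D_0; then
-- D_1 is a single vertex, and D_{m+1} has vertex set Fin (1 + |D_m| + |D_m|):
-- vertex zero is w, then the copy T₁, then the copy T₂.

dsz : ℕ → ℕ
dsz zero = zero
dsz (suc m) = suc (dsz m + dsz m)

part : ∀ a → Fin (suc (a + a)) → ⊤ ⊎ (Fin a ⊎ Fin a)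
part a Fin.zero = inj₁ tt
part a (Fin.suc i) = inj₂ (splitAt a i)

Dadj : (m : ℕ) → Fin (dsz m) → Fin (dsz m) → Bool
Dadj (suc m) u v = go (part (dsz m) u) (part (dsz m) v)
  where
  go : ⊤ ⊎ (Fin (dsz m) ⊎ Fin (dsz m)) → ⊤ ⊎ (Fin (dsz m) ⊎ Fin (dsz m)) → Bool
  go (inj₁ _) (inj₁ _) = false
  go (inj₁ _) (inj₂ (inj₁ _)) = true
  go (inj₁ _) (inj₂ (inj₂ _)) = false
  go (inj₂ (inj₁ _)) (inj₁ _) = false
  go (inj₂ (inj₂ _)) (inj₁ _) = true
  go (inj₂ (inj₁ i)) (inj₂ (inj₁ j)) = Dadj m i j
  go (inj₂ (inj₂ i)) (inj₂ (inj₂ j)) = Dadj m i j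
  go (inj₂ (inj₁ _)) (inj₂ (inj₂ _)) = true
  go (inj₂ (inj₂ _)) (inj₂ (inj₁ _)) = false

ContainsD : (T : Tournament) → Subset (size T) → ℕ → Set
ContainsD T X m = ContainsIn T X (dsz m) (Dadj m)

-- Direction, to state both the lemma and its out/in-swapped version.

data Dir : Set where
  out in' : Dir

flip : Dir → Dir
flip out = in'
flip in' = out

Nb : Dir → (T : Tournament) → Fin (size T) → Subset (size T)
Nb out = N⁺
Nb in' = N⁻

module Submission where

-- Split B according to whether the (flip σ)-neighbourhood of a vertex meets A in a set with
-- ω⃗ ≥ c.  Concatenating orderings shows that ω⃗ is subadditive over partitions, so either the
-- bad part has ω⃗ ≥ c_large, which is alternative (b), or the good part has ω⃗ ≥ g(x) with
-- x = (1 + |D_{n-1}|)·c_small.  Applying g to the subtournament induced on the good part gives a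
-- good vertex w whose σ-neighbourhood in B has ω⃗ ≥ x, while its (flip σ)-neighbourhood in A
-- contains a copy D₂ of D_{n-1}.  Each vertex of D₂ lies in A, so its σ-neighbourhood in B has
-- ω⃗ < c_small; removing these |D_{n-1}| neighbourhoods from that of w (subadditivity again)
-- leaves a set C with ω⃗(C) ≥ c_small ≥ c, and C contains a copy D₁ of D_{n-1}.  No vertex of C
-- is a σ-neighbour of D₂, so w → D₁ → D₂ → w (arcs in direction σ) is a copy of D_n.

open import Defs
open import Data.Nat using (ℕ; zero; suc; _+_; _*_; _∸_; _≤_; _≤?_; z≤n; s≤s)
open import Data.Nat.Properties
  using (+-comm; +-assoc; +-cancelˡ-≤; +-monoˡ-≤; ≰⇒≥; ≤-trans; ≤-reflexive; module ≤-Reasoning)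
open import Data.Bool using (Bool; true; false; not)
import Data.Bool as Bool
open import Data.Bool.Properties using (¬-not)
open import Data.Fin using (Fin; zero; suc; join; splitAt)
open import Data.Fin.Properties using (_≟_; any?; all?; injective⇒≤; join-splitAt)
open import Data.Fin.Subset using (Subset; _∈_; _∉_; _⊆_; _∩_)
open import Data.Fin.Subset.Properties using (_∈?_; x∈p∩q⁺; x∈p∩q⁻; p∩q⊆p; p∩q⊆q)
open import Data.Vec using (tabulate)
open import Data.Vec.Properties using (lookup∘tabulate; lookup⇒[]=; []=⇒lookup)
open import Data.List using (List; []; _∷_; length; _++_; map; filter; allFin)
import Data.List as List
open import Data.List.Properties using (length-++; length-map)
open import Data.List.Membership.Propositional using () renaming (_∈_ to _∈ₗ_)
open import Data.List.Membership.Propositional.Properties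
  using (∈-lookup; ∈-map⁺; ∈-map⁻; ∈-++⁻; ∈-++⁺ˡ; ∈-++⁺ʳ; ∈-filter⁺; ∈-filter⁻; ∈-allFin)
import Data.List.Membership.DecPropositional as DecMembership
import Data.List.Relation.Unary.Any as Any
open import Data.List.Relation.Unary.Any.Properties using (lookup-index)
open import Data.List.Relation.Unary.All as All using (All; []; _∷_)
open import Data.List.Relation.Unary.AllPairs using (AllPairs; []; _∷_; allPairs?)
import Data.List.Relation.Unary.AllPairs.Properties as AllPairs
open import Data.List.Relation.Unary.Unique.Propositional using (Unique)
import Data.List.Relation.Unary.Unique.Propositional.Properties as Unique
import Data.List.Relation.Unary.Unique.DecPropositional as DecUnique
open import Data.List.Relation.Binary.Sublist.Propositional
  using ([]; _∷_; _∷ʳ_) renaming (_⊆_ to _⊑_; ⊆-refl to ⊑-refl; ⊆-trans to ⊑-trans)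
open import Data.List.Relation.Binary.Sublist.Propositional.Properties
  using (All-resp-⊆; length-mono-≤; map⁺; filter-⊆; ++⁺ˡ; ++⁺ʳ)
import Data.List.Relation.Binary.Sublist.DecPropositional as DecSublist
open import Data.Product using (Σ; ∃; ∃₂; _×_; _,_; proj₁; proj₂)
open import Data.Sum using (_⊎_; inj₁; inj₂; [_,_]′)
open import Data.Sum.Properties using (inj₂-injective)
open import Data.Empty using (⊥; ⊥-elim)
open import Data.Unit using (⊤)
open import Function using (_∘_)
open import Function.Definitions using (Injective)
open import Relation.Binary.PropositionalEquality
  using (_≡_; _≢_; refl; sym; trans; cong; cong₂; subst; module ≡-Reasoning)
open import Relation.Nullary using (¬_; Dec; yes; no; does; ¬?)
open import Relation.Nullary.Decidable using (map′; _×-dec_; _⊎-dec_; _→-dec_; decidable-stable; dec-true)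
open import Relation.Unary using (Decidable)

∈-tabulate⁺ : ∀ {n} {f : Fin n → Bool} {x} → f x ≡ true → x ∈ tabulate f
∈-tabulate⁺ {f = f} {x} fx = lookup⇒[]= x _ (trans (lookup∘tabulate f x) fx)

∈-tabulate⁻ : ∀ {n} {f : Fin n → Bool} {x} → x ∈ tabulate f → f x ≡ true
∈-tabulate⁻ {f = f} {x} x∈ = trans (sym (lookup∘tabulate f x)) ([]=⇒lookup x∈)

select : ∀ {n} {P : Fin n → Set} → Decidable P → Subset n
select P? = tabulate (does ∘ P?)

∈-select⁺ : ∀ {n} {P : Fin n → Set} (P? : Decidable P) {x} → P x → x ∈ select P?
∈-select⁺ P? {x} px = ∈-tabulate⁺ (dec-true (P? x) px)

∈-select⁻ : ∀ {n} {P : Fin n → Set} (P? : Decidable P) {x} → x ∈ select P? → P x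
∈-select⁻ P? {x} x∈ with P? x | ∈-tabulate⁻ {f = does ∘ P?} x∈
... | yes px | _  = px
... | no _   | ()

∩-monoʳ-⊆ : ∀ {n} {p q r : Subset n} → q ⊆ r → p ∩ q ⊆ p ∩ r
∩-monoʳ-⊆ q⊆r x∈ = let (x∈p , x∈q) = x∈p∩q⁻ _ _ x∈ in x∈p∩q⁺ (x∈p , q⊆r x∈q)

lookup-injective : ∀ {A : Set} {xs : List A} → Unique xs → Injective _≡_ _≡_ (List.lookup xs)
lookup-injective {xs = x ∷ xs} (x∉xs ∷ u) {zero}  {zero}  _ = refl
lookup-injective {xs = x ∷ xs} (x∉xs ∷ u) {zero}  {suc j} e = ⊥-elim (All.lookup x∉xs (∈-lookup j) e)
lookup-injective {xs = x ∷ xs} (x∉xs ∷ u) {suc i} {zero}  e = ⊥-elim (All.lookup x∉xs (∈-lookup i) (sym e))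
lookup-injective {xs = x ∷ xs} (x∉xs ∷ u) {suc i} {suc j} e = cong suc (lookup-injective u e)

any-list? : ∀ {m} {P : List (Fin m) → Set} → Decidable P → ∀ j → Dec (∃ λ l → length l ≤ j × P l)
any-list? P? zero = map′ (λ p → [] , z≤n , p) (λ { ([] , _ , p) → p }) (P? [])
any-list? {P = P} P? (suc j) = map′ cons uncons (P? [] ⊎-dec any? λ x → any-list? (P? ∘ (x ∷_)) j)
  where
  cons : P [] ⊎ ∃ (λ x → ∃ λ l → length l ≤ j × P (x ∷ l)) → ∃ λ l → length l ≤ suc j × P l
  cons (inj₁ p) = [] , z≤n , p
  cons (inj₂ (x , l , l≤j , p)) = x ∷ l , s≤s l≤j , p
  uncons : (∃ λ l → length l ≤ suc j × P l) → P [] ⊎ ∃ (λ x → ∃ λ l → length l ≤ j × P (x ∷ l))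
  uncons ([] , _ , p) = inj₁ p
  uncons (x ∷ l , s≤s l≤j , p) = inj₂ (x , l , l≤j , p)

⊑-++⁻ : ∀ {A : Set} {S : List A} xs ys → S ⊑ xs ++ ys
      → ∃₂ λ S₁ S₂ → S ≡ S₁ ++ S₂ × S₁ ⊑ xs × S₂ ⊑ ys
⊑-++⁻ [] ys S⊑ys = [] , _ , refl , [] , S⊑ys
⊑-++⁻ (x ∷ xs) ys (.x ∷ʳ S⊑) with ⊑-++⁻ xs ys S⊑
... | S₁ , S₂ , refl , S₁⊑ , S₂⊑ = S₁ , S₂ , refl , x ∷ʳ S₁⊑ , S₂⊑
⊑-++⁻ (x ∷ xs) ys (refl ∷ S⊑) with ⊑-++⁻ xs ys S⊑
... | S₁ , S₂ , refl , S₁⊑ , S₂⊑ = x ∷ S₁ , S₂ , refl , refl ∷ S₁⊑ , S₂⊑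

⊑-map⁻ : ∀ {A B : Set} (f : A → B) {S} xs → S ⊑ map f xs → ∃ λ S′ → S′ ⊑ xs × S ≡ map f S′
⊑-map⁻ f [] [] = [] , [] , refl
⊑-map⁻ f (x ∷ xs) (_ ∷ʳ S⊑) with ⊑-map⁻ f xs S⊑
... | S′ , S′⊑ , refl = S′ , x ∷ʳ S′⊑ , refl
⊑-map⁻ f (x ∷ xs) (refl ∷ S⊑) with ⊑-map⁻ f xs S⊑
... | S′ , S′⊑ , refl = x ∷ S′ , refl ∷ S′⊑ , refl

AllPairs-resp-⊑ : ∀ {A : Set} {R : A → A → Set} {xs ys} → ys ⊑ xs → AllPairs R xs → AllPairs R ys
AllPairs-resp-⊑ [] [] = []
AllPairs-resp-⊑ (_ ∷ʳ ys⊑) (_ ∷ rs) = AllPairs-resp-⊑ ys⊑ rs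
AllPairs-resp-⊑ (refl ∷ ys⊑) (r ∷ rs) = All-resp-⊆ ys⊑ r ∷ AllPairs-resp-⊑ ys⊑ rs

module _ (T : Tournament) where

  -- ωB≥ T o k is, by definition, HasBackedgeClique (list o) k.
  HasBackedgeClique : List (Fin (size T)) → ℕ → Set
  HasBackedgeClique l k =
    Σ (List (Fin (size T))) λ S → (S ⊑ l × AllPairs (λ u v → adj T v u ≡ true) S) × k ≤ length S

  hasBackedgeClique? : ∀ l k → Dec (HasBackedgeClique l k)
  hasBackedgeClique? l k =
    map′ (λ (S , _ , clique) → S , clique) (λ (S , clique) → S , length-mono-≤ (proj₁ (proj₁ clique)) , clique)
      (any-list? (λ S → (DecSublist._⊆?_ _≟_ S l ×-dec allPairs? (λ u v → adj T v u Bool.≟ true) S)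
                        ×-dec k ≤? length S)
                 (length l))

  HasBackedgeClique-++ : ∀ l₁ l₂ a b → HasBackedgeClique (l₁ ++ l₂) (a + b)
                       → HasBackedgeClique l₁ a ⊎ HasBackedgeClique l₂ b
  HasBackedgeClique-++ l₁ l₂ a b (S , (S⊑ , clique) , a+b≤∣S∣) with ⊑-++⁻ l₁ l₂ S⊑
  ... | S₁ , S₂ , refl , S₁⊑ , S₂⊑ with a ≤? length S₁
  ...   | yes a≤∣S₁∣ = inj₁ (S₁ , (S₁⊑ , AllPairs-resp-⊑ (++⁺ʳ S₂ ⊑-refl) clique) , a≤∣S₁∣)
  ...   | no a≰∣S₁∣ =
    inj₂ (S₂ , (S₂⊑ , AllPairs-resp-⊑ (++⁺ˡ S₁ ⊑-refl) clique) , +-cancelˡ-≤ a b (length S₂) a+b≤a+∣S₂∣)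
    where
    open ≤-Reasoning
    a+b≤a+∣S₂∣ : a + b ≤ a + length S₂
    a+b≤a+∣S₂∣ = begin
      a + b                   ≤⟨ a+b≤∣S∣ ⟩
      length (S₁ ++ S₂)       ≡⟨ length-++ S₁ ⟩
      length S₁ + length S₂   ≤⟨ +-monoˡ-≤ (length S₂) (≰⇒≥ a≰∣S₁∣) ⟩
      a + length S₂           ∎

  OrderingWithoutClique : Subset (size T) → ℕ → List (Fin (size T)) → Set
  OrderingWithoutClique X k l =
    Unique l × (∀ v → v ∈ₗ l → v ∈ X) × (∀ v → v ∈ X → v ∈ₗ l) × ¬ HasBackedgeClique l k

  orderingWithoutClique? : ∀ X k → Decidable (OrderingWithoutClique X k)
  orderingWithoutClique? X k l =
    DecUnique.unique? _≟_ l ×-dec all? (λ v → v ∈ₗ? l →-dec v ∈? X) ×-dec all? (λ v → v ∈? X →-dec v ∈ₗ? l)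
      ×-dec ¬? (hasBackedgeClique? l k)
    where _∈ₗ?_ = DecMembership._∈?_ _≟_

  -- An ordering is a duplicate-free list, hence has length at most size T, so searching the
  -- lists of that length finds an ordering without a k-clique whenever there is one.
  ω⃗≥-or-counterexample : ∀ X k → ω⃗[ T ] X ≥ k ⊎ Σ (Ordering T X) λ o → ¬ ωB≥ T o k
  ω⃗≥-or-counterexample X k with any-list? (orderingWithoutClique? X k) (size T)
  ... | yes (l , _ , u , s , c , ¬clique) =
    inj₂ (record { list = l ; unique = u ; sound = s ; complete = c } , ¬clique)
  ... | no ∄counterexample = inj₁ λ o → decidable-stable (hasBackedgeClique? (list o) k) λ ¬clique →
    ∄counterexample
      (list o , injective⇒≤ (lookup-injective (unique o)) , unique o , sound o , complete o , ¬clique)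

  ω⃗≥? : ∀ X k → Dec (ω⃗[ T ] X ≥ k)
  ω⃗≥? X k = [ yes , (λ (o , ¬clique) → no λ X-large → ¬clique (X-large o)) ]′ (ω⃗≥-or-counterexample X k)

  ω⃗≥-weaken : ∀ {X k k′} → k ≤ k′ → ω⃗[ T ] X ≥ k′ → ω⃗[ T ] X ≥ k
  ω⃗≥-weaken k≤k′ X-large o = let (S , clique , k′≤∣S∣) = X-large o in S , clique , ≤-trans k≤k′ k′≤∣S∣

  ω⃗-mono : ∀ {X Y k} → X ⊆ Y → ω⃗[ T ] X ≥ k → ω⃗[ T ] Y ≥ k
  ω⃗-mono {X} X⊆Y X-large o =
    let (S , (S⊑ , clique) , k≤∣S∣) = X-large oₓ
    in S , (⊑-trans S⊑ (filter-⊆ (_∈? X) (list o)) , clique) , k≤∣S∣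
    where
    oₓ : Ordering T X
    oₓ = record
      { list = filter (_∈? X) (list o)
      ; unique = Unique.filter⁺ (_∈? X) (unique o)
      ; sound = λ v v∈ → proj₂ (∈-filter⁻ (_∈? X) {xs = list o} v∈)
      ; complete = λ v v∈X → ∈-filter⁺ (_∈? X) (complete o v (X⊆Y v∈X)) v∈X
      }

  ω⃗-subadditive : ∀ {X Y Z} a b → Y ⊆ X → Z ⊆ X → (∀ {v} → v ∈ Y → v ∉ Z) → (∀ {v} → v ∈ X → v ∈ Y ⊎ v ∈ Z)
                → ω⃗[ T ] X ≥ a + b → ω⃗[ T ] Y ≥ a ⊎ ω⃗[ T ] Z ≥ b
  ω⃗-subadditive {X} {Y} {Z} a b Y⊆X Z⊆X Y∩Z=∅ X⊆Y∪Z X-large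
    with ω⃗≥-or-counterexample Y a | ω⃗≥-or-counterexample Z b
  ... | inj₁ Y-large | _ = inj₁ Y-large
  ... | inj₂ _ | inj₁ Z-large = inj₂ Z-large
  ... | inj₂ (oʸ , ¬cliqueʸ) | inj₂ (oᶻ , ¬cliqueᶻ) =
    ⊥-elim ([ ¬cliqueʸ , ¬cliqueᶻ ]′ (HasBackedgeClique-++ (list oʸ) (list oᶻ) a b (X-large oʸᶻ)))
    where
    oʸᶻ : Ordering T X
    oʸᶻ = record
      { list = list oʸ ++ list oᶻ
      ; unique = Unique.++⁺ (unique oʸ) (unique oᶻ)
                   λ (v∈oʸ , v∈oᶻ) → Y∩Z=∅ (sound oʸ _ v∈oʸ) (sound oᶻ _ v∈oᶻ)
      ; sound = λ v v∈ → [ Y⊆X ∘ sound oʸ v , Z⊆X ∘ sound oᶻ v ]′ (∈-++⁻ (list oʸ) v∈)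
      ; complete = λ v v∈X → [ ∈-++⁺ˡ ∘ complete oʸ v , ∈-++⁺ʳ (list oʸ) ∘ complete oᶻ v ]′ (X⊆Y∪Z v∈X)
      }

  ω⃗-split : ∀ {X} {P : Fin (size T) → Set} (P? : Decidable P) a b → ω⃗[ T ] X ≥ a + b
          → ω⃗[ T ] (X ∩ select P?) ≥ a ⊎ ω⃗[ T ] (X ∩ select (¬? ∘ P?)) ≥ b
  ω⃗-split {X} P? a b = ω⃗-subadditive a b (p∩q⊆p _ _) (p∩q⊆p _ _) disjoint cover
    where
    disjoint : ∀ {v} → v ∈ X ∩ select P? → v ∉ X ∩ select (¬? ∘ P?)
    disjoint v∈Y v∈Z = ∈-select⁻ (¬? ∘ P?) (proj₂ (x∈p∩q⁻ _ _ v∈Z)) (∈-select⁻ P? (proj₂ (x∈p∩q⁻ _ _ v∈Y)))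
    cover : ∀ {v} → v ∈ X → v ∈ X ∩ select P? ⊎ v ∈ X ∩ select (¬? ∘ P?)
    cover {v} v∈X with P? v
    ... | yes pv = inj₁ (x∈p∩q⁺ (v∈X , ∈-select⁺ P? pv))
    ... | no ¬pv = inj₂ (x∈p∩q⁺ (v∈X , ∈-select⁺ (¬? ∘ P?) ¬pv))

module Induced (T : Tournament) {m} (f : Fin m → Fin (size T)) (f-injective : Injective _≡_ _≡_ f) where

  induced : Tournament
  induced = record
    { size = m
    ; adj = λ i j → adj T (f i) (f j)
    ; irrefl = λ i → irrefl T (f i)
    ; tourn = λ i j i≢j → tourn T (f i) (f j) (i≢j ∘ f-injective)
    }

  _MapsOnto_ : Subset m → Subset (size T) → Set
  X′ MapsOnto X = (∀ {i} → i ∈ X′ → f i ∈ X) × (∀ {v} → v ∈ X → ∃ λ i → f i ≡ v × i ∈ X′)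

  preimage-list : ∀ l → All (λ v → ∃ λ i → f i ≡ v) l → ∃ λ l′ → map f l′ ≡ l
  preimage-list [] [] = [] , refl
  preimage-list (v ∷ l) ((i , fi≡v) ∷ preimages) =
    let (l′ , map-f-l′≡l) = preimage-list l preimages in i ∷ l′ , cong₂ _∷_ fi≡v map-f-l′≡l

  map-ordering : ∀ {X′ X} → X′ MapsOnto X → Ordering induced X′ → Ordering T X
  map-ordering {X = X} (into , onto) o′ = record
    { list = map f (list o′)
    ; unique = Unique.map⁺ f-injective (unique o′)
    ; sound = λ v v∈ → let (i , i∈ , v≡fi) = ∈-map⁻ f v∈ in subst (_∈ X) (sym v≡fi) (into (sound o′ i i∈))
    ; complete = λ v v∈X → let (i , fi≡v , i∈X′) = onto v∈X
                           in subst (_∈ₗ _) fi≡v (∈-map⁺ f (complete o′ i i∈X′))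
    }

  pull-ordering : ∀ {X′ X} → X′ MapsOnto X → (o : Ordering T X)
                → Σ (Ordering induced X′) λ o′ → map f (list o′) ≡ list o
  pull-ordering {X′} (into , onto) o = o′ , map-f-l′≡o
    where
    preimages : ∃ λ l′ → map f l′ ≡ list o
    preimages = preimage-list (list o) (All.tabulate λ {v} v∈ → let (i , fi≡v , _) = onto (sound o v v∈)
                                                               in i , fi≡v)
    l′ : List (Fin m)
    l′ = proj₁ preimages
    map-f-l′≡o : map f l′ ≡ list o
    map-f-l′≡o = proj₂ preimages
    o′ : Ordering induced X′
    o′ = record
      { list = l′
      ; unique = Unique.map⁻ (subst Unique (sym map-f-l′≡o) (unique o))
      ; sound = λ i i∈ →
          let (j , fj≡fi , j∈X′) = onto (sound o (f i) (subst (f i ∈ₗ_) map-f-l′≡o (∈-map⁺ f i∈)))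
          in subst (_∈ X′) (f-injective fj≡fi) j∈X′
      ; complete = λ i i∈X′ →
          let (j , j∈ , fi≡fj) = ∈-map⁻ f (subst (f i ∈ₗ_) (sym map-f-l′≡o) (complete o (f i) (into i∈X′)))
          in subst (_∈ₗ l′) (sym (f-injective fi≡fj)) j∈
      }

  ω⃗-reflect : ∀ {X′ X k} → X′ MapsOnto X → ω⃗[ T ] X ≥ k → ω⃗[ induced ] X′ ≥ k
  ω⃗-reflect {k = k} X′↠X X-large o′ with X-large (map-ordering X′↠X o′)
  ... | S , (S⊑ , clique) , k≤∣S∣ with ⊑-map⁻ f (list o′) S⊑
  ...   | S′ , S′⊑ , refl = S′ , (S′⊑ , AllPairs.map⁻ clique) , subst (k ≤_) (length-map f S′) k≤∣S∣

  ω⃗-preserve : ∀ {X′ X k} → X′ MapsOnto X → ω⃗[ induced ] X′ ≥ k → ω⃗[ T ] X ≥ k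
  ω⃗-preserve {k = k} X′↠X X′-large o =
    let (o′ , map-f-o′≡o) = pull-ordering X′↠X o
        (S′ , (S′⊑ , clique) , k≤∣S′∣) = X′-large o′
    in map f S′ , (subst (map f S′ ⊑_) map-f-o′≡o (map⁺ f S′⊑) , AllPairs.map⁺ clique)
     , subst (k ≤_) (sym (length-map f S′)) k≤∣S′∣

  ∈Nb-induced⁺ : ∀ σ {i j} → j ∈ Nb σ induced i → f j ∈ Nb σ T (f i)
  ∈Nb-induced⁺ out j∈ = ∈-tabulate⁺ (∈-tabulate⁻ j∈)
  ∈Nb-induced⁺ in' j∈ = ∈-tabulate⁺ (∈-tabulate⁻ j∈)

  ∈Nb-induced⁻ : ∀ σ {i j} → f j ∈ Nb σ T (f i) → j ∈ Nb σ induced i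
  ∈Nb-induced⁻ out fj∈ = ∈-tabulate⁺ (∈-tabulate⁻ fj∈)
  ∈Nb-induced⁻ in' fj∈ = ∈-tabulate⁺ (∈-tabulate⁻ fj∈)

enumerate : ∀ {n} (Y : Subset n)
          → Σ ℕ λ m → Σ (Fin m → Fin n) λ f
              → Injective _≡_ _≡_ f × (∀ i → f i ∈ Y) × (∀ {v} → v ∈ Y → ∃ λ i → f i ≡ v)
enumerate {n} Y =
  length Y-list , List.lookup Y-list , lookup-injective (Unique.filter⁺ (_∈? Y) (Unique.allFin⁺ n))
  , (λ i → proj₂ (∈-filter⁻ (_∈? Y) {xs = allFin n} (∈-lookup i)))
  , λ {v} v∈Y → let v∈Y-list = ∈-filter⁺ (_∈? Y) (∈-allFin v) v∈Y
                in Any.index v∈Y-list , sym (lookup-index v∈Y-list)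
  where
  Y-list : List (Fin n)
  Y-list = filter (_∈? Y) (allFin n)

HasLargeNeighbourhoods : Dir → (ℕ → ℕ) → Set
HasLargeNeighbourhoods σ g = ∀ x (T′ : Tournament) → ω⃗[ T′ ] V T′ ≥ g x → ∃ λ v → ω⃗[ T′ ] Nb σ T′ v ≥ x

large-neighbourhoods : ∀ σ {g} → (∀ (x : ℕ) (T′ : Tournament) → ω⃗[ T′ ] V T′ ≥ g x
                                   → Σ (Fin (size T′)) (λ v → ω⃗[ T′ ] N⁺ T′ v ≥ x)
                                     × Σ (Fin (size T′)) (λ v → ω⃗[ T′ ] N⁻ T′ v ≥ x))
                     → HasLargeNeighbourhoods σ g
large-neighbourhoods out both x T′ T′-large = proj₁ (both x T′ T′-large)
large-neighbourhoods in' both x T′ T′-large = proj₂ (both x T′ T′-large)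

large-neighbourhood-within : ∀ {σ g} → HasLargeNeighbourhoods σ g → ∀ T Y x → ω⃗[ T ] Y ≥ g x
                           → ∃ λ w → w ∈ Y × ω⃗[ T ] (Nb σ T w ∩ Y) ≥ x
large-neighbourhood-within {σ} large-nbhd T Y x Y-large with enumerate Y
... | m , f , f-injective , f∈Y , onto =
  let (i , Nb-large) = large-nbhd x induced (ω⃗-reflect V↠Y Y-large)
  in f i , f∈Y i , ω⃗-preserve (Nb↠Nb∩Y i) Nb-large
  where
  open Induced T f f-injective

  V↠Y : V induced MapsOnto Y
  V↠Y = (λ {i} _ → f∈Y i) , λ v∈Y → let (i , fi≡v) = onto v∈Y in i , fi≡v , ∈-tabulate⁺ refl

  Nb↠Nb∩Y : ∀ i → Nb σ induced i MapsOnto (Nb σ T (f i) ∩ Y)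
  Nb↠Nb∩Y i = (λ {j} j∈ → x∈p∩q⁺ (∈Nb-induced⁺ σ j∈ , f∈Y j))
            , λ v∈ → let (v∈N , v∈Y) = x∈p∩q⁻ _ _ v∈ ; (j , fj≡v) = onto v∈Y
                     in j , fj≡v , ∈Nb-induced⁻ σ (subst (_∈ Nb σ T (f i)) (sym fj≡v) v∈N)

arc : Dir → (T : Tournament) → Fin (size T) → Fin (size T) → Bool
arc out T u v = adj T u v
arc in' T u v = adj T v u

module _ (T : Tournament) where

  ∈Nb⁺ : ∀ σ {u v} → arc σ T u v ≡ true → v ∈ Nb σ T u
  ∈Nb⁺ out = ∈-tabulate⁺
  ∈Nb⁺ in' = ∈-tabulate⁺

  ∈Nb⁻ : ∀ σ {u v} → v ∈ Nb σ T u → arc σ T u v ≡ true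
  ∈Nb⁻ out = ∈-tabulate⁻
  ∈Nb⁻ in' = ∈-tabulate⁻

  ∈Nb-flip⁻ : ∀ σ {u v} → u ∈ Nb (flip σ) T v → arc σ T u v ≡ true
  ∈Nb-flip⁻ out = ∈-tabulate⁻
  ∈Nb-flip⁻ in' = ∈-tabulate⁻

  adj⇒≢ : ∀ {u v} → adj T u v ≡ true → u ≢ v
  adj⇒≢ {u} uv refl with trans (sym uv) (irrefl T u)
  ... | ()

  adj-asym : ∀ {u v} → adj T u v ≡ true → adj T v u ≡ false
  adj-asym {u} {v} uv = trans (tourn T v u (adj⇒≢ uv ∘ sym)) (cong not uv)

  adj-reverse : ∀ {u v} → u ≢ v → adj T u v ≡ false → adj T v u ≡ true
  adj-reverse {u} {v} u≢v ¬uv = trans (tourn T v u (u≢v ∘ sym)) (cong not ¬uv)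

  arc-reverse : ∀ σ {u v} → u ≢ v → arc σ T u v ≡ false → arc σ T v u ≡ true
  arc-reverse out u≢v = adj-reverse u≢v
  arc-reverse in' u≢v = adj-reverse (u≢v ∘ sym)

  IsCopyOfD : ∀ m → (Fin (dsz m) → Fin (size T)) → Set
  IsCopyOfD m h = Injective _≡_ _≡_ h × (∀ i j → adj T (h i) (h j) ≡ Dadj m i j)

  ContainsD-suc : ∀ {m} w (h₁ h₂ : Fin (dsz m) → Fin (size T)) → IsCopyOfD m h₁ → IsCopyOfD m h₂
                → (∀ a → adj T w (h₁ a) ≡ true) → (∀ a b → adj T (h₁ a) (h₂ b) ≡ true)
                → (∀ b → adj T (h₂ b) w ≡ true)
                → ContainsD T (V T) (suc m)
  ContainsD-suc {m} w h₁ h₂ (h₁-injective , h₁-adj) (h₂-injective , h₂-adj) w⇒h₁ h₁⇒h₂ h₂⇒w =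
    place ∘ part d , part-injective ∘ place-injective , (λ _ → ∈-tabulate⁺ refl) , place-adj
    where
    d : ℕ
    d = dsz m

    place : ⊤ ⊎ (Fin d ⊎ Fin d) → Fin (size T)
    place (inj₁ _) = w
    place (inj₂ (inj₁ a)) = h₁ a
    place (inj₂ (inj₂ b)) = h₂ b

    part-injective : Injective _≡_ _≡_ (part d)
    part-injective {zero} {zero} _ = refl
    part-injective {suc i} {suc j} e = cong suc (begin
      i                         ≡⟨ join-splitAt d d i ⟨
      join d d (splitAt d i)    ≡⟨ cong (join d d) (inj₂-injective e) ⟩
      join d d (splitAt d j)    ≡⟨ join-splitAt d d j ⟩
      j                         ∎)
      where open ≡-Reasoning

    place-injective : Injective _≡_ _≡_ place
    place-injective {inj₁ _} {inj₁ _} _ = refl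
    place-injective {inj₁ _} {inj₂ (inj₁ a)} e = ⊥-elim (adj⇒≢ (w⇒h₁ a) e)
    place-injective {inj₁ _} {inj₂ (inj₂ b)} e = ⊥-elim (adj⇒≢ (h₂⇒w b) (sym e))
    place-injective {inj₂ (inj₁ a)} {inj₁ _} e = ⊥-elim (adj⇒≢ (w⇒h₁ a) (sym e))
    place-injective {inj₂ (inj₂ b)} {inj₁ _} e = ⊥-elim (adj⇒≢ (h₂⇒w b) e)
    place-injective {inj₂ (inj₁ a)} {inj₂ (inj₁ a′)} e = cong (inj₂ ∘ inj₁) (h₁-injective e)
    place-injective {inj₂ (inj₂ b)} {inj₂ (inj₂ b′)} e = cong (inj₂ ∘ inj₂) (h₂-injective e)
    place-injective {inj₂ (inj₁ a)} {inj₂ (inj₂ b)} e = ⊥-elim (adj⇒≢ (h₁⇒h₂ a b) e)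
    place-injective {inj₂ (inj₂ b)} {inj₂ (inj₁ a)} e = ⊥-elim (adj⇒≢ (h₁⇒h₂ a b) (sym e))

    place-adj : ∀ u v → adj T (place (part d u)) (place (part d v)) ≡ Dadj (suc m) u v
    place-adj u v with part d u | part d v
    ... | inj₁ _         | inj₁ _         = irrefl T w
    ... | inj₁ _         | inj₂ (inj₁ a)  = w⇒h₁ a
    ... | inj₁ _         | inj₂ (inj₂ b)  = adj-asym (h₂⇒w b)
    ... | inj₂ (inj₁ a)  | inj₁ _         = adj-asym (w⇒h₁ a)
    ... | inj₂ (inj₂ b)  | inj₁ _         = h₂⇒w b
    ... | inj₂ (inj₁ a)  | inj₂ (inj₁ a′) = h₁-adj a a′
    ... | inj₂ (inj₂ b)  | inj₂ (inj₂ b′) = h₂-adj b b′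
    ... | inj₂ (inj₁ a)  | inj₂ (inj₂ b)  = h₁⇒h₂ a b
    ... | inj₂ (inj₂ b)  | inj₂ (inj₁ a)  = adj-asym (h₁⇒h₂ a b)

  ContainsD-suc-along : ∀ σ {m} w (h₁ h₂ : Fin (dsz m) → Fin (size T)) → IsCopyOfD m h₁ → IsCopyOfD m h₂
                      → (∀ a → arc σ T w (h₁ a) ≡ true) → (∀ a b → arc σ T (h₁ a) (h₂ b) ≡ true)
                      → (∀ b → arc σ T (h₂ b) w ≡ true)
                      → ContainsD T (V T) (suc m)
  ContainsD-suc-along out = ContainsD-suc
  ContainsD-suc-along in' w h₁ h₂ h₁-copy h₂-copy w←h₁ h₁←h₂ h₂←w =
    ContainsD-suc w h₂ h₁ h₂-copy h₁-copy h₂←w (λ b a → h₁←h₂ a b) w←h₁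

  avoid-neighbourhoods : ∀ σ {B cs d} (h : Fin d → Fin (size T)) → (∀ i → ω⃗[ T ] (Nb σ T (h i) ∩ B) < cs)
                       → ∀ {X} r → X ⊆ B → ω⃗[ T ] X ≥ d * cs + r
                       → Σ (Subset (size T)) λ C
                           → C ⊆ X × (∀ {u} → u ∈ C → ∀ i → u ∉ Nb σ T (h i)) × ω⃗[ T ] C ≥ r
  avoid-neighbourhoods σ {d = zero} h sparse {X} r X⊆B X-large = X , (λ u∈X → u∈X) , (λ _ ()) , X-large
  avoid-neighbourhoods σ {B} {cs} {suc d} h sparse {X} r X⊆B X-large
    with ω⃗-split T (_∈? Nb σ T (h zero)) cs (d * cs + r) (subst (ω⃗[ T ] X ≥_) (+-assoc cs (d * cs) r) X-large)
  ... | inj₁ X∩N₀-large = ⊥-elim (sparse zero (ω⃗-mono T X∩N₀⊆N₀∩B X∩N₀-large))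
    where
    X∩N₀⊆N₀∩B : X ∩ select (_∈? Nb σ T (h zero)) ⊆ Nb σ T (h zero) ∩ B
    X∩N₀⊆N₀∩B u∈ = let (u∈X , u∈N₀) = x∈p∩q⁻ _ _ u∈ in x∈p∩q⁺ (∈-select⁻ (_∈? _) u∈N₀ , X⊆B u∈X)
  ... | inj₂ X∖N₀-large =
    let (C , C⊆X∖N₀ , C-avoids , C-large) =
          avoid-neighbourhoods σ (h ∘ suc) (sparse ∘ suc) r (λ u∈ → X⊆B (p∩q⊆p _ _ u∈)) X∖N₀-large
    in C , (λ u∈C → p∩q⊆p _ _ (C⊆X∖N₀ u∈C))
         , (λ { u∈C zero → ∈-select⁻ (¬? ∘ (_∈? _)) (proj₂ (x∈p∩q⁻ _ _ (C⊆X∖N₀ u∈C)))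
              ; u∈C (suc i) → C-avoids u∈C i })
         , C-large

  ContainsD-suc-around : ∀ σ {m c cs A B} → (∀ X → ω⃗[ T ] X ≥ c → ContainsD T X m) → c ≤ cs
                       → (∀ v → v ∈ A → v ∈ B → ⊥) → (∀ v → v ∈ A → ω⃗[ T ] (Nb σ T v ∩ B) < cs)
                       → ∀ w → ω⃗[ T ] (Nb (flip σ) T w ∩ A) ≥ c → ω⃗[ T ] (Nb σ T w ∩ B) ≥ suc (dsz m) * cs
                       → ContainsD T (V T) (suc m)
  ContainsD-suc-around σ {m} {c} {cs} {A} {B} D-in c≤cs A∩B=∅ A-sparse w back-large forward-large
    with D-in _ back-large
  ... | h₂ , h₂-injective , h₂∈ , h₂-adj
    with avoid-neighbourhoods σ h₂ (λ b → A-sparse (h₂ b) (proj₂ (x∈p∩q⁻ _ _ (h₂∈ b)))) cs (p∩q⊆q _ _)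
           (ω⃗≥-weaken T (≤-reflexive (+-comm (dsz m * cs) cs)) forward-large)
  ... | C , C⊆ , C-avoids , C-large
    with D-in C (ω⃗≥-weaken T c≤cs C-large)
  ... | h₁ , h₁-injective , h₁∈ , h₁-adj =
    ContainsD-suc-along σ w h₁ h₂ (h₁-injective , h₁-adj) (h₂-injective , h₂-adj) w→h₁ h₁→h₂ h₂→w
    where
    w→h₁ : ∀ a → arc σ T w (h₁ a) ≡ true
    w→h₁ a = ∈Nb⁻ σ (proj₁ (x∈p∩q⁻ _ _ (C⊆ (h₁∈ a))))
    h₂→w : ∀ b → arc σ T (h₂ b) w ≡ true
    h₂→w b = ∈Nb-flip⁻ σ (proj₁ (x∈p∩q⁻ _ _ (h₂∈ b)))
    h₁→h₂ : ∀ a b → arc σ T (h₁ a) (h₂ b) ≡ true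
    h₁→h₂ a b = arc-reverse σ h₂≢h₁ (¬-not λ h₂→h₁ → C-avoids (h₁∈ a) b (∈Nb⁺ σ h₂→h₁))
      where
      h₂≢h₁ : h₂ b ≢ h₁ a
      h₂≢h₁ h₂≡h₁ = A∩B=∅ (h₁ a) (subst (_∈ A) h₂≡h₁ (proj₂ (x∈p∩q⁻ _ _ (h₂∈ b))))
                                 (proj₂ (x∈p∩q⁻ _ _ (C⊆ (h₁∈ a))))

lemma5p3 : (n : ℕ) → 2 ≤ n → (g : ℕ → ℕ)
    → (∀ (x : ℕ) (T′ : Tournament) → ω⃗[ T′ ] V T′ ≥ g x
        → Σ (Fin (size T′)) (λ v → ω⃗[ T′ ] N⁺ T′ v ≥ x)
          × Σ (Fin (size T′)) (λ v → ω⃗[ T′ ] N⁻ T′ v ≥ x))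
    → (T : Tournament) (c : ℕ)
    → (∀ (X : Subset (size T)) → ω⃗[ T ] X ≥ c → ContainsD T X (n ∸ 1))
    → (csmall clarge : ℕ) → c ≤ csmall
    → (A B : Subset (size T))
    → (∀ v → v ∈ A → v ∈ B → ⊥)
    → (σ : Dir)
    → ω⃗[ T ] A ≥ clarge
    → ω⃗[ T ] B ≥ clarge + g (suc (dsz (n ∸ 1)) * csmall)
    → (∀ v → v ∈ A → ω⃗[ T ] (Nb σ T v ∩ B) < csmall)
    → ContainsD T (V T) n
      ⊎ Σ (Subset (size T)) (λ B₂ → B₂ ⊆ B × (ω⃗[ T ] B₂ ≥ clarge)
          × (∀ w → w ∈ B₂ → ω⃗[ T ] (Nb (flip σ) T w ∩ A) < c))
lemma5p3 zero ()
lemma5p3 (suc m) _ g g-spec T c D-in csmall clarge c≤csmall A B A∩B=∅ σ _ B-large A-sparse =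
  [ inj₁ ∘ D-from-good-part , inj₂ ∘ B₂-from-bad-part ]′
    (ω⃗-split T good? (g x) clarge (subst (ω⃗[ T ] B ≥_) (+-comm clarge (g x)) B-large))
  where
  x : ℕ
  x = suc (dsz m) * csmall

  good? : ∀ w → Dec (ω⃗[ T ] (Nb (flip σ) T w ∩ A) ≥ c)
  good? w = ω⃗≥? T (Nb (flip σ) T w ∩ A) c

  D-from-good-part : ω⃗[ T ] (B ∩ select good?) ≥ g x → ContainsD T (V T) (suc m)
  D-from-good-part good-large =
    let (w , w∈ , forward-large) =
          large-neighbourhood-within {σ} (large-neighbourhoods σ g-spec) T _ x good-large
    in ContainsD-suc-around T σ D-in c≤csmall A∩B=∅ A-sparse w (∈-select⁻ good? (proj₂ (x∈p∩q⁻ _ _ w∈)))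
         (ω⃗-mono T (∩-monoʳ-⊆ (p∩q⊆p _ _)) forward-large)

  B₂-from-bad-part : ω⃗[ T ] (B ∩ select (¬? ∘ good?)) ≥ clarge
                   → Σ (Subset (size T)) λ B₂ → B₂ ⊆ B × ω⃗[ T ] B₂ ≥ clarge
                       × (∀ w → w ∈ B₂ → ω⃗[ T ] (Nb (flip σ) T w ∩ A) < c)
  B₂-from-bad-part bad-large =
    B ∩ select (¬? ∘ good?) , p∩q⊆p _ _ , bad-large , λ w w∈ → ∈-select⁻ (¬? ∘ good?) (proj₂ (x∈p∩q⁻ _ _ w∈))
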